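{- Let $G$ be a (finite, simple, connected) graph with at least two vertices, and suppose $S\subseteq V(G\,\square\,G)$ resolves $G\,\square\,G$. Let $A=\{a\in V(G): (a,b)\in S\text{ for some }b\}$ and $B=\{b\in V(G): (a,b)\in S \text{ for some } a\}$ be the two projections of $S$ onto $G$. Then $A\cup B$ is a doubly resolving set of $G$. In particular, $\beta(G\,\square\,G)\geq \tfrac12\psi(G)$.
   Context: All graphs are finite, undirected, simple and connected; $d(v,w)$ denotes distance. A vertex $x$ resolves $v,w$ if $d(v,x)\neq d(w,x)$; a set $S$ resolves a graph if every pair of distinct vertices is resolved by some vertex of $S$; $\beta(G)$ is the minimum size of a resolving set. For $G\neq K_1$, vertices $v,w$ are doubly resolved by $x,y$ if $d(v,x)-d(w,x)\neq d(v,y)-d(w,y)$; a set is doubly resolving if every pair of distinct vertices is doubly resolved by two vertices of the set; $\psi(G)$ is the minimum size of a doubly resolving set. The cartesian product $G\,\square\,H$ has vertex set $V(G)\times V(H)$, with $(a,v)\sim(b,w)$ iff ($a=b$ and $vw\in E(H)$) or ($v=w$ and $ab\in E(G)$). -}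

module Defs where

open import Level using (Level; 0ℓ)
open import Data.Nat using (ℕ; zero; suc; _≤_; _*_)
open import Data.Integer using (ℤ; +_; _-_)
open import Data.Fin using (Fin)
open import Data.Fin.Subset using (Subset; _∈_; ∣_∣)
open import Data.Product using (Σ; ∃; ∃-syntax; _×_; _,_)
open import Data.Sum using (_⊎_)
open import Data.List using (List; length)
import Data.List.Membership.Propositional as LMem
open import Relation.Binary.PropositionalEquality using (_≡_; _≢_)
open import Relation.Nullary using (¬_)

record Graph (V : Set) : Set₁ where
  field
    _~_   : V → V → Set
    sym   : ∀ {u v} → u ~ v → v ~ u
    irrefl : ∀ {v} → ¬ (v ~ v)

module _ {V : Set} (G : Graph V) where
  open Graph G

  data Walk : V → V → ℕ → Set where
    here : ∀ v → Walk v v zero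
    step : ∀ {u v w k} → u ~ v → Walk v w k → Walk u w (suc k)

  Connected : Set
  Connected = ∀ u v → ∃[ k ] Walk u v k

  IsDist : V → V → ℕ → Set
  IsDist u v k = Walk u v k × (∀ m → Walk u v m → k ≤ m)

  Resolves : V → V → V → Set
  Resolves x v w = ∀ a b → IsDist v x a → IsDist w x b → a ≢ b

  DoublyResolvedBy : V → V → V → V → Set
  DoublyResolvedBy x y v w =
    ∀ a b c d → IsDist v x a → IsDist w x b → IsDist v y c → IsDist w y d →
      (+ a - + b) ≢ (+ c - + d)

  IsResolving : (V → Set) → Set
  IsResolving S = ∀ v w → v ≢ w → ∃[ x ] (S x × Resolves x v w)

  IsDoublyResolving : (V → Set) → Set
  IsDoublyResolving D =
    ∀ v w → v ≢ w → ∃[ x ] ∃[ y ] (D x × D y × DoublyResolvedBy x y v w)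

_□_ : {V W : Set} → Graph V → Graph W → Graph (V × W)
_□_ {V} {W} G H = record
  { _~_ = E
  ; sym = s
  ; irrefl = ir
  }
  where
  module G = Graph G
  module H = Graph H
  E : V × W → V × W → Set
  E (a , v) (b , w) = (a ≡ b × v H.~ w) ⊎ (v ≡ w × a G.~ b)
  s : ∀ {p q} → E p q → E q p
  s (Data.Sum.inj₁ (_≡_.refl , e)) = Data.Sum.inj₁ (_≡_.refl , H.sym e)
  s (Data.Sum.inj₂ (_≡_.refl , e)) = Data.Sum.inj₂ (_≡_.refl , G.sym e)
  ir : ∀ {p} → ¬ E p p
  ir (Data.Sum.inj₁ (_ , e)) = H.irrefl e
  ir (Data.Sum.inj₂ (_ , e)) = G.irrefl e

module _ {n : ℕ} where
  open LMem using () renaming (_∈_ to _∈ₗ_)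

  ListSet : List (Fin n × Fin n) → (Fin n × Fin n → Set)
  ListSet S p = p ∈ₗ S

  ProjUnion : List (Fin n × Fin n) → (Fin n → Set)
  ProjUnion S c = (∃[ b ] ((c , b) ∈ₗ S)) ⊎ (∃[ a ] ((a , c) ∈ₗ S))

  SubsetPred : Subset n → (Fin n → Set)
  SubsetPred D x = x ∈ D

{-# OPTIONS --safe #-}
-- The vertex (x , y) of G □ G that resolves (v , w) and (w , v) gives
-- d(v,x) + d(w,y) ≠ d(w,x) + d(v,y), because distances in G □ G add up over
-- the coordinates.  Rearranged, this says that x and y doubly resolve v and w,
-- and x, y lie in the first and second projection of S respectively.
module Submission where

open import Defs
open import Data.Nat using (ℕ; _≤_; _*_; _+_; suc; z≤n; s≤s)
open import Data.Nat.Properties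
  using (+-suc; *-suc; +-mono-≤; +-monoʳ-≤; ≤-reflexive; ≤-trans; m≤n⇒m≤1+n; module ≤-Reasoning)
open import Data.Integer as ℤ using (ℤ; +_; _-_)
import Data.Integer.Properties as ℤ
open import Data.Integer.Tactic.RingSolver using (solve-∀)
open import Data.Fin using (Fin)
open import Data.Fin.Subset using (Subset; ∣_∣; _∪_; ⁅_⁆; ⊥; inside; outside)
  renaming (_∈_ to _∈ₛ_)
open import Data.Fin.Subset.Properties using (x∈⁅x⁆; p⊆p∪q; q⊆p∪q; ∣⊥∣≡0; ∣⁅x⁆∣≡1)
open import Data.Product as Product using (_×_; ∃-syntax; _,_; proj₁; proj₂)
open import Data.Sum using (_⊎_; inj₁; inj₂)
open import Data.List using (List; length; []; _∷_)
open import Data.List.Membership.Propositional using () renaming (_∈_ to _∈ₗ_)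
open import Data.List.Relation.Unary.Any using (here; there)
open import Data.Vec using ([]; _∷_)
open import Relation.Binary.PropositionalEquality using (_≡_; refl; cong; cong₂; sym; module ≡-Reasoning)

walk-++ : ∀ {V} {G : Graph V} {u v w k l} → Walk G u v k → Walk G v w l → Walk G u w (k + l)
walk-++ (here _)   q = q
walk-++ (step e p) q = step e (walk-++ p q)

module _ {V W : Set} {G : Graph V} {H : Graph W} where

  walk-□ˡ : ∀ {a b k} (v : W) → Walk G a b k → Walk (G □ H) (a , v) (b , v) k
  walk-□ˡ v (here a)   = here (a , v)
  walk-□ˡ v (step e p) = step (inj₂ (refl , e)) (walk-□ˡ v p)

  walk-□ʳ : ∀ {v w l} (a : V) → Walk H v w l → Walk (G □ H) (a , v) (a , w) l
  walk-□ʳ a (here v)   = here (a , v)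
  walk-□ʳ a (step e p) = step (inj₁ (refl , e)) (walk-□ʳ a p)

  walk-□-split : ∀ {a b v w m} → Walk (G □ H) (a , v) (b , w) m →
    ∃[ k ] ∃[ l ] (Walk G a b k × Walk H v w l × k + l ≡ m)
  walk-□-split (here _) = 0 , 0 , here _ , here _ , refl
  walk-□-split (step (inj₁ (refl , e)) p) with walk-□-split p
  ... | k , l , p₁ , p₂ , refl = k , suc l , p₁ , step e p₂ , +-suc k l
  walk-□-split (step (inj₂ (refl , e)) p) with walk-□-split p
  ... | k , l , p₁ , p₂ , refl = suc k , l , step e p₁ , p₂ , refl

  IsDist-□ : ∀ {a b v w k l} → IsDist G a b k → IsDist H v w l →
    IsDist (G □ H) (a , v) (b , w) (k + l)
  IsDist-□ {a} {b} {v} {w} {k} {l} (p₁ , min₁) (p₂ , min₂) =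
    walk-++ (walk-□ˡ v p₁) (walk-□ʳ b p₂) , λ m p → shortest (walk-□-split p)
    where
    shortest : ∀ {m} → ∃[ k′ ] ∃[ l′ ] (Walk G a b k′ × Walk H v w l′ × k′ + l′ ≡ m) → k + l ≤ m
    shortest (k′ , l′ , q₁ , q₂ , refl) = +-mono-≤ (min₁ k′ q₁) (min₂ l′ q₂)

m-n≡o-p⇒m+p≡n+o : ∀ m n o p → + m - + n ≡ + o - + p → m + p ≡ n + o
m-n≡o-p⇒m+p≡n+o m n o p eq = ℤ.+-injective (begin
  + m ℤ.+ + p                        ≡⟨ left (+ m) (+ n) (+ p) ⟩
  (+ m - + n) ℤ.+ (+ n ℤ.+ + p)      ≡⟨ cong (ℤ._+ (+ n ℤ.+ + p)) eq ⟩
  (+ o - + p) ℤ.+ (+ n ℤ.+ + p)      ≡⟨ right (+ n) (+ o) (+ p) ⟩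
  + n ℤ.+ + o                        ∎)
  where
  open ≡-Reasoning
  left : ∀ (m n p : ℤ) → m ℤ.+ p ≡ (m - n) ℤ.+ (n ℤ.+ p)
  left = solve-∀
  right : ∀ (n o p : ℤ) → (o - p) ℤ.+ (n ℤ.+ p) ≡ n ℤ.+ o
  right = solve-∀

module _ {V : Set} (G : Graph V) where

  Resolves-swap⇒DoublyResolvedBy : ∀ {x y v w} →
    Resolves (G □ G) (x , y) (v , w) (w , v) → DoublyResolvedBy G x y v w
  Resolves-swap⇒DoublyResolvedBy r a b c d da db dc dd eq =
    r (a + d) (b + c) (IsDist-□ da dd) (IsDist-□ db dc) (m-n≡o-p⇒m+p≡n+o a b c d eq)

  IsResolving-□⇒IsDoublyResolving-projections : (S : V × V → Set) →
    IsResolving (G □ G) S →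
    IsDoublyResolving G (λ c → (∃[ b ] S (c , b)) ⊎ (∃[ a ] S (a , c)))
  IsResolving-□⇒IsDoublyResolving-projections S res v w v≢w
    with res (v , w) (w , v) (λ eq → v≢w (cong proj₁ eq))
  ... | (x , y) , xy∈S , r =
    x , y , inj₁ (y , xy∈S) , inj₂ (x , xy∈S) , Resolves-swap⇒DoublyResolvedBy r

  IsDoublyResolving-mono : {D D′ : V → Set} → (∀ {x} → D x → D′ x) →
    IsDoublyResolving G D → IsDoublyResolving G D′
  IsDoublyResolving-mono D⊆D′ dr v w v≢w with dr v w v≢w
  ... | x , y , x∈D , y∈D , r = x , y , D⊆D′ x∈D , D⊆D′ y∈D , r

∣p∪q∣≤∣p∣+∣q∣ : ∀ {n} (p q : Subset n) → ∣ p ∪ q ∣ ≤ ∣ p ∣ + ∣ q ∣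
∣p∪q∣≤∣p∣+∣q∣ []            []            = z≤n
∣p∪q∣≤∣p∣+∣q∣ (inside  ∷ p) (inside  ∷ q) =
  s≤s (≤-trans (m≤n⇒m≤1+n (∣p∪q∣≤∣p∣+∣q∣ p q)) (≤-reflexive (sym (+-suc ∣ p ∣ ∣ q ∣))))
∣p∪q∣≤∣p∣+∣q∣ (inside  ∷ p) (outside ∷ q) = s≤s (∣p∪q∣≤∣p∣+∣q∣ p q)
∣p∪q∣≤∣p∣+∣q∣ (outside ∷ p) (inside  ∷ q) =
  ≤-trans (s≤s (∣p∪q∣≤∣p∣+∣q∣ p q)) (≤-reflexive (sym (+-suc ∣ p ∣ ∣ q ∣)))
∣p∪q∣≤∣p∣+∣q∣ (outside ∷ p) (outside ∷ q) = ∣p∪q∣≤∣p∣+∣q∣ p q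

projections : ∀ {n} → List (Fin n × Fin n) → Subset n
projections []            = ⊥
projections ((a , b) ∷ S) = ⁅ a ⁆ ∪ ⁅ b ⁆ ∪ projections S

∈⇒∈-projections : ∀ {n} {S : List (Fin n × Fin n)} {a b} →
  (a , b) ∈ₗ S → a ∈ₛ projections S × b ∈ₛ projections S
∈⇒∈-projections {S = (a , b) ∷ S} (here refl) =
  p⊆p∪q _ (x∈⁅x⁆ a) , q⊆p∪q ⁅ a ⁆ _ (p⊆p∪q _ (x∈⁅x⁆ b))
∈⇒∈-projections {S = (a , b) ∷ S} (there ab∈S) =
  Product.map inward inward (∈⇒∈-projections ab∈S)
  where
  inward : ∀ {x} → x ∈ₛ projections S → x ∈ₛ projections ((a , b) ∷ S)
  inward x∈ = q⊆p∪q ⁅ a ⁆ _ (q⊆p∪q ⁅ b ⁆ _ x∈)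

ProjUnion⊆projections : ∀ {n} (S : List (Fin n × Fin n)) {c} → ProjUnion S c → c ∈ₛ projections S
ProjUnion⊆projections S (inj₁ (_ , cb∈S)) = proj₁ (∈⇒∈-projections cb∈S)
ProjUnion⊆projections S (inj₂ (_ , ac∈S)) = proj₂ (∈⇒∈-projections ac∈S)

∣projections∣≤2*length : ∀ {n} (S : List (Fin n × Fin n)) → ∣ projections S ∣ ≤ 2 * length S
∣projections∣≤2*length {n} [] = ≤-reflexive (∣⊥∣≡0 n)
∣projections∣≤2*length ((a , b) ∷ S) = begin
  ∣ ⁅ a ⁆ ∪ ⁅ b ⁆ ∪ projections S ∣          ≤⟨ ∣p∪q∣≤∣p∣+∣q∣ ⁅ a ⁆ _ ⟩
  ∣ ⁅ a ⁆ ∣ + ∣ ⁅ b ⁆ ∪ projections S ∣      ≤⟨ +-monoʳ-≤ ∣ ⁅ a ⁆ ∣ (∣p∪q∣≤∣p∣+∣q∣ ⁅ b ⁆ _) ⟩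
  ∣ ⁅ a ⁆ ∣ + (∣ ⁅ b ⁆ ∣ + ∣ projections S ∣) ≡⟨ cong₂ (λ i j → i + (j + ∣ projections S ∣)) (∣⁅x⁆∣≡1 a) (∣⁅x⁆∣≡1 b) ⟩
  2 + ∣ projections S ∣                      ≤⟨ +-monoʳ-≤ 2 (∣projections∣≤2*length S) ⟩
  2 + 2 * length S                           ≡⟨ *-suc 2 (length S) ⟨
  2 * length ((a , b) ∷ S)                   ∎
  where open ≤-Reasoning

lemma4p2 : (n : ℕ) → 2 ≤ n → (G : Graph (Fin n)) → Connected G →
    (S : List (Fin n × Fin n)) → IsResolving (G □ G) (ListSet S) →
    IsDoublyResolving G (ProjUnion S)
    × (∃[ D ] (IsDoublyResolving G (SubsetPred D) × ∣ D ∣ ≤ 2 * length S))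
lemma4p2 n _ G _ S res =
  projUnion-dr ,
  projections S ,
  IsDoublyResolving-mono G (ProjUnion⊆projections S) projUnion-dr ,
  ∣projections∣≤2*length S
  where
  projUnion-dr : IsDoublyResolving G (ProjUnion S)
  projUnion-dr = IsResolving-□⇒IsDoublyResolving-projections G (ListSet S) res
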